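{- Let $P$ be a finite poset on a set $K$, $D$ a nonempty downset of $P$, and $m$ a positive integer. Then $$m\cdot e(m,P-D)\le 2^{|DP\setminus D|}\,e(m,P).$$
   Context: $DP=\{y\in K\mid x\le_P y\text{ for some }x\in D\}$ is the up-closure of $D$, and $P-D$ is the subposet induced on $K\setminus D$. For a finite poset $Q$ on $L$ and a finite set $M$ disjoint from $L$ with $|M|=m$, $e(m,Q)$ is the number of partial orders on $M\cup L$ inducing $Q$ on $L$ whose set of minimal elements is exactly $M$. -}

module Defs where

open import Data.Nat using (ℕ; zero; suc; _+_)
open import Data.Fin using (Fin; _↑ˡ_; _↑ʳ_) renaming (zero to fz; suc to fs)
open import Data.Fin.Properties using (_≟_)
open import Data.Bool using (Bool; true; false; T; not; _∧_; _∨_; _xor_)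
open import Data.List using (List; []; _∷_; [_]; map; concatMap; length; filterᵇ; allFin)
open import Data.Bool.ListAction using (any; all)
open import Data.Product using (∃)
open import Relation.Nullary.Decidable using (⌊_⌋)
open import Relation.Binary.PropositionalEquality using (_≡_)

BRel : ℕ → Set
BRel n = Fin n → Fin n → Bool

record IsPartialOrder {n : ℕ} (R : BRel n) : Set where
  field
    reflexive     : ∀ x → T (R x x)
    antisymmetric : ∀ x y → T (R x y) → T (R y x) → x ≡ y
    transitive    : ∀ x y z → T (R x y) → T (R y z) → T (R x z)

Subset : ℕ → Set
Subset n = Fin n → Bool

IsDownset : {n : ℕ} → BRel n → Subset n → Set
IsDownset {n} P D = ∀ (x y : Fin n) → T (D y) → T (P x y) → T (D x)

allF : (n : ℕ) → (Fin n → Bool) → Bool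
allF n p = all p (allFin n)

anyF : (n : ℕ) → (Fin n → Bool) → Bool
anyF n p = any p (allFin n)

countF : (n : ℕ) → (Fin n → Bool) → ℕ
countF n p = length (filterᵇ p (allFin n))

_==F_ : {n : ℕ} → Fin n → Fin n → Bool
x ==F y = ⌊ x ≟ y ⌋

_==B_ : Bool → Bool → Bool
a ==B b = not (a xor b)

isPartialOrderᵇ : {n : ℕ} → BRel n → Bool
isPartialOrderᵇ {n} R =
  allF n (λ x → R x x)
  ∧ allF n (λ x → allF n (λ y → not (R x y ∧ R y x) ∨ (x ==F y)))
  ∧ allF n (λ x → allF n (λ y → allF n (λ z → not (R x y ∧ R y z) ∨ R x z)))

isMinimalᵇ : {n : ℕ} → BRel n → Fin n → Bool
isMinimalᵇ {n} R x = allF n (λ y → not (R y x) ∨ (y ==F x))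

funs : {A : Set} (n : ℕ) → List A → List (Fin n → A)
funs zero    xs = [ (λ ()) ]
funs (suc n) xs =
  concatMap (λ a → map (λ f → λ { fz → a ; (fs i) → f i }) (funs n xs)) xs

allBRel : (n : ℕ) → List (BRel n)
allBRel n = funs n (funs n (true ∷ false ∷ []))

-- e(m, Q).  The ground set M ∪ L is Fin (m + k): M = {i ↑ˡ k | i : Fin m}
-- (the first m elements), L = {m ↑ʳ j | j : Fin k} (carrying Q).

isExtensionᵇ : (m : ℕ) {k : ℕ} → BRel k → BRel (m + k) → Bool
isExtensionᵇ m {k} Q R =
  isPartialOrderᵇ R
  ∧ allF k (λ i → allF k (λ j → R (m ↑ʳ i) (m ↑ʳ j) ==B Q i j))
  ∧ allF m (λ i → isMinimalᵇ R (i ↑ˡ k))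
  ∧ allF k (λ j → not (isMinimalᵇ R (m ↑ʳ j)))

e : (m : ℕ) {k : ℕ} → BRel k → ℕ
e m {k} Q = length (filterᵇ (isExtensionᵇ m Q) (allBRel (m + k)))

induce : {n k : ℕ} → BRel n → (Fin k → Fin n) → BRel k
induce P f i j = P (f i) (f j)

upDiffSize : {n : ℕ} → BRel n → Subset n → ℕ
upDiffSize {n} P D = countF n (λ x → not (D x) ∧ anyF n (λ y → D y ∧ P y x))

{-# OPTIONS --safe #-}
-- Given a ∈ M and an extension R′ of P − D, glue them into an extension of P: keep P on K,
-- keep R′ between M and K ∖ D, and put a below every element of D and of DP ∖ D, so that a is
-- the only element of M below D. The gluing forgets only which elements of DP ∖ D lay above a
-- in R′; recording that subset makes (a, R′) ↦ (subset, glued order) injective, since a is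
-- recovered as the unique element of M below the nonempty D.
module Submission where

open import Level using (Level; 0ℓ)
open import Data.Nat using (ℕ; zero; suc; _+_; _*_; _^_; _≤_; z≤n; s≤s)
open import Data.Nat.Properties using (module ≤-Reasoning)
open import Data.Fin using (Fin; zero; suc; _↑ˡ_; _↑ʳ_; splitAt; join; _≟_)
open import Data.Fin.Properties
  using (splitAt-↑ˡ; splitAt-↑ʳ; splitAt⁻¹-↑ˡ; splitAt⁻¹-↑ʳ; splitAt-join; join-splitAt)
open import Data.Fin.Properties using (↑ˡ-injective; ¬∀⟶∃¬; all?)
open import Data.Fin.Induction using (po-wellFounded)
open import Data.Bool using (Bool; true; false; T; not; _∧_; _∨_; if_then_else_)
open import Data.Bool.Properties using (T-∧; T-∨; T-≡; T-not-≡)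
open import Data.List using (List; []; _∷_; _++_; map; concatMap; length; filterᵇ; allFin; lookup)
open import Data.List using (cartesianProductWith; cartesianProduct)
open import Data.List.Properties using (length-++; length-map; length-removeAt′; length-tabulate)
open import Data.List.Relation.Unary.All as All using (All; []; _∷_)
import Data.List.Relation.Unary.All.Properties as All
open import Data.List.Relation.Unary.Any using (Any; here; there; index; _─_; satisfied)
import Data.List.Relation.Unary.Any.Properties as Any
open import Data.List.Relation.Unary.AllPairs using ([]; _∷_)
open import Data.List.Relation.Unary.Unique.Setoid using (Unique)
import Data.List.Relation.Unary.Unique.Setoid.Properties as Unique
open import Data.List.Relation.Unary.Unique.Propositional.Properties using (allFin⁺)
open import Data.List.Relation.Unary.Enumerates.Setoid using (IsEnumeration)
import Data.List.Membership.Setoid as SetoidMembership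
import Data.List.Membership.Setoid.Properties as Membershipₚ
open import Data.List.Membership.Propositional using (lose)
open import Data.List.Membership.Propositional.Properties using (∈-allFin; ∈-filter⁺; ∈-filter⁻)
import Data.Vec.Functional.Relation.Binary.Equality.Setoid as Pointwise
open import Data.Sum using (_⊎_; inj₁; inj₂)
import Data.Sum as Sum
open import Data.Product using (∃; _×_; _,_; proj₁; proj₂)
import Data.Product as Product
open import Data.Product.Relation.Binary.Pointwise.NonDependent using (_×ₛ_)
open import Data.Empty using (⊥-elim)
open import Function using (_∘_; _⇔_; mk⇔; Equivalence)
open import Induction.WellFounded using (Acc; acc)
open import Relation.Binary.Bundles using (Setoid)
import Relation.Binary.Structures as Structures
open import Relation.Binary.PropositionalEquality as ≡ using (_≡_; _≢_; refl; cong; subst)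
open import Relation.Nullary using (¬_; Dec; yes; no; contradiction)
open import Relation.Nullary.Decidable using (T?; _→-dec_; toWitness; fromWitness)
open import Defs

open Equivalence using (to; from)

private
  variable
    a b ℓ ℓ₁ ℓ₂ : Level
    A B C : Set a

module _ (S : Setoid a ℓ) where
  open Setoid S
  open SetoidMembership S using (_∈_)

  ∈-─⁺ : ∀ {x y ys} (x∈ys : x ∈ ys) → y ∈ ys → ¬ x ≈ y → y ∈ (ys ─ x∈ys)
  ∈-─⁺ (here x≈z)   (here y≈z)   x≉y = contradiction (trans x≈z (sym y≈z)) x≉y
  ∈-─⁺ (here _)     (there y∈ys) _   = y∈ys
  ∈-─⁺ (there _)    (here y≈z)   _   = here y≈z
  ∈-─⁺ (there x∈ys) (there y∈ys) x≉y = there (∈-─⁺ x∈ys y∈ys x≉y)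

  Unique-⊆⇒length≤ : ∀ {xs ys} → Unique S xs → All (_∈ ys) xs → length xs ≤ length ys
  Unique-⊆⇒length≤ []            []              = z≤n
  Unique-⊆⇒length≤ {_ ∷ xs} {ys} (x≉xs ∷ xs!) (x∈ys ∷ xs⊆ys) = begin
    suc (length xs)           ≤⟨ s≤s (Unique-⊆⇒length≤ xs! xs⊆ys─x) ⟩
    suc (length (ys ─ x∈ys))  ≡⟨ length-removeAt′ ys (index x∈ys) ⟨
    length ys                 ∎
    where
    open ≤-Reasoning
    xs⊆ys─x = All.zipWith (λ (y∈ys , x≉y) → ∈-─⁺ x∈ys y∈ys x≉y) (xs⊆ys , x≉xs)

module _ (S₁ : Setoid a ℓ₁) (S₂ : Setoid b ℓ₂) where
  open Setoid S₁ using () renaming (Carrier to A₁; _≈_ to _≈₁_)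
  open Setoid S₂ using () renaming (Carrier to A₂; _≈_ to _≈₂_)

  map⁺-injectiveOn : ∀ {p} {P : A₁ → Set p} {f : A₁ → A₂} {xs} →
            (∀ {x y} → P x → P y → f x ≈₂ f y → x ≈₁ y) →
            All P xs → Unique S₁ xs → Unique S₂ (map f xs)
  map⁺-injectiveOn f-inj []         []           = []
  map⁺-injectiveOn f-inj (px ∷ pxs) (x≉xs ∷ xs!) =
    All.map⁺ (All.zipWith (λ (py , x≉y) fx≈fy → x≉y (f-inj px py fx≈fy)) (pxs , x≉xs))
    ∷ map⁺-injectiveOn f-inj pxs xs!

concatMap-map≡cartesianProductWith : ∀ (f : A → B → C) xs ys →
                concatMap (λ x → map (f x) ys) xs ≡ cartesianProductWith f xs ys
concatMap-map≡cartesianProductWith f []       ys = refl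
concatMap-map≡cartesianProductWith f (x ∷ xs) ys =
  cong (map (f x) ys ++_) (concatMap-map≡cartesianProductWith f xs ys)

length-cartesianProductWith : ∀ (f : A → B → C) xs ys →
  length (cartesianProductWith f xs ys) ≡ length xs * length ys
length-cartesianProductWith f []       ys = refl
length-cartesianProductWith f (x ∷ xs) ys = begin
  length (map (f x) ys ++ cartesianProductWith f xs ys) ≡⟨ length-++ (map (f x) ys) ⟩
  length (map (f x) ys) + length (cartesianProductWith f xs ys)
    ≡⟨ ≡.cong₂ _+_ (length-map (f x) ys) (length-cartesianProductWith f xs ys) ⟩
  length ys + length xs * length ys ∎
  where open ≡.≡-Reasoning

module _ (S : Setoid 0ℓ ℓ) where
  open Pointwise S using (_≋_; ≋-setoid)

  funs-unique : ∀ n {xs} → Unique S xs → Unique (≋-setoid n) (funs n xs)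
  funs-unique zero    _         = [] ∷ []
  funs-unique (suc n) {xs} xs! =
    subst (Unique (≋-setoid (suc n))) (≡.sym (concatMap-map≡cartesianProductWith _ xs (funs n xs)))
      (Unique.cartesianProductWith⁺ S (≋-setoid n) (≋-setoid (suc n)) _
        (λ eq → eq zero , eq ∘ suc) xs! (funs-unique n xs!))

  funs-enumerates : ∀ n {xs} → IsEnumeration S xs → IsEnumeration (≋-setoid n) (funs n xs)
  funs-enumerates zero    _            g = here (λ ())
  funs-enumerates (suc n) {xs} _∈xs g =
    subst (Any (g ≋_)) (≡.sym (concatMap-map≡cartesianProductWith _ xs (funs n xs)))
      (Any.cartesianProductWith⁺ _ (λ g₀≈x g₊≋h → λ { zero → g₀≈x ; (suc i) → g₊≋h i })
        (g zero ∈xs) (funs-enumerates n _∈xs (g ∘ suc)))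

length-funs : ∀ {A : Set} n (xs : List A) → length (funs n xs) ≡ length xs ^ n
length-funs zero    xs = refl
length-funs (suc n) xs = begin
  length (funs (suc n) xs)
    ≡⟨ cong length (concatMap-map≡cartesianProductWith _ xs (funs n xs)) ⟩
  length (cartesianProductWith _ xs (funs n xs)) ≡⟨ length-cartesianProductWith _ xs (funs n xs) ⟩
  length xs * length (funs n xs)                 ≡⟨ cong (length xs *_) (length-funs n xs) ⟩
  length xs * length xs ^ n                      ∎
  where open ≡.≡-Reasoning

bools : List Bool
bools = true ∷ false ∷ []

bools-unique : Unique (≡.setoid Bool) bools
bools-unique = ((λ ()) ∷ []) ∷ [] ∷ []

bools-enumerates : IsEnumeration (≡.setoid Bool) bools
bools-enumerates true  = here refl
bools-enumerates false = there (here refl)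

Subsets : ℕ → Setoid 0ℓ 0ℓ
Subsets = Pointwise.≋-setoid (≡.setoid Bool)

Relations : ℕ → Setoid 0ℓ 0ℓ
Relations n = Pointwise.≋-setoid (Subsets n) n

allBRel-unique : ∀ n → Unique (Relations n) (allBRel n)
allBRel-unique n = funs-unique (Subsets n) n (funs-unique (≡.setoid Bool) n bools-unique)

allBRel-enumerates : ∀ n → IsEnumeration (Relations n) (allBRel n)
allBRel-enumerates n =
  funs-enumerates (Subsets n) n (funs-enumerates (≡.setoid Bool) n bools-enumerates)

T-not : ∀ {b} → T (not b) ⇔ (¬ T b)
T-not {true}  = mk⇔ (λ ()) (λ ¬t → ¬t _)
T-not {false} = mk⇔ (λ _ ()) _

T-dichotomy : ∀ b → T b ⊎ T (not b)
T-dichotomy true  = inj₁ _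
T-dichotomy false = inj₂ _

T-not-∨ : ∀ {a b} → T (not a ∨ b) ⇔ (T a → T b)
T-not-∨ {true}  = mk⇔ (λ b _ → b) (λ h → h _)
T-not-∨ {false} = mk⇔ (λ _ ()) _

T-==B : ∀ {a b} → T (a ==B b) ⇔ a ≡ b
T-==B {true}  {true}  = mk⇔ (λ _ → refl) _
T-==B {true}  {false} = mk⇔ (λ ()) (λ ())
T-==B {false} {true}  = mk⇔ (λ ()) (λ ())
T-==B {false} {false} = mk⇔ (λ _ → refl) _

T-⇔→≡ : ∀ {a b} → (T a ⇔ T b) → a ≡ b
T-⇔→≡ {true}  {true}  _ = refl
T-⇔→≡ {true}  {false} h = ⊥-elim (to h _)
T-⇔→≡ {false} {true}  h = ⊥-elim (from h _)
T-⇔→≡ {false} {false} _ = refl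

T-==F : ∀ {n} {x y : Fin n} → T (x ==F y) ⇔ x ≡ y
T-==F = mk⇔ toWitness fromWitness

T-allF : ∀ n {p : Fin n → Bool} → T (allF n p) ⇔ (∀ x → T (p x))
T-allF n {p} = mk⇔
  (λ h x → All.lookup (All.all⁺ p (allFin n) h) (∈-allFin x))
  (λ h → All.all⁻ p (All.tabulate⁺ h))

T-anyF : ∀ n {p : Fin n → Bool} → T (anyF n p) ⇔ ∃ (T ∘ p)
T-anyF n {p} = mk⇔
  (λ h → satisfied (Any.any⁻ p (allFin n) h))
  (λ (x , px) → Any.any⁺ p (lose (∈-allFin x) px))

T-isPartialOrderᵇ : ∀ {n} {R : BRel n} → T (isPartialOrderᵇ R) ⇔ IsPartialOrder R
T-isPartialOrderᵇ {n} {R} = mk⇔ decode encode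
  where
  reflᵇ antisymᵇ transᵇ : Bool
  reflᵇ    = allF n λ x → R x x
  antisymᵇ = allF n λ x → allF n λ y → not (R x y ∧ R y x) ∨ (x ==F y)
  transᵇ   = allF n λ x → allF n λ y → allF n λ z → not (R x y ∧ R y z) ∨ R x z

  decode : T (isPartialOrderᵇ R) → IsPartialOrder R
  decode h with to (T-∧ {reflᵇ}) h
  ... | r , h′ with to (T-∧ {antisymᵇ}) h′
  ... | a , t = record
    { reflexive     = to (T-allF n) r
    ; antisymmetric = λ x y p q → to T-==F (to T-not-∨ (at a x y) (from T-∧ (p , q)))
    ; transitive    = λ x y z p q → to T-not-∨ (to (T-allF n) (at t x y) z) (from T-∧ (p , q))
    }
    where
    at : ∀ {p : Fin n → Fin n → Bool} → T (allF n λ x → allF n (p x)) → ∀ x y → T (p x y)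
    at h x = to (T-allF n) (to (T-allF n) h x)

  encode : IsPartialOrder R → T (isPartialOrderᵇ R)
  encode po = from T-∧ (from (T-allF n) reflexive , from T-∧ (antisymᵇ-holds , transᵇ-holds))
    where
    open IsPartialOrder po
    antisymᵇ-holds : T antisymᵇ
    antisymᵇ-holds = from (T-allF n) λ x → from (T-allF n) λ y → from T-not-∨ λ pq →
      from T-==F (antisymmetric x y (proj₁ (to T-∧ pq)) (proj₂ (to T-∧ pq)))
    transᵇ-holds : T transᵇ
    transᵇ-holds = from (T-allF n) λ x → from (T-allF n) λ y → from (T-allF n) λ z →
      from T-not-∨ λ pq →
      transitive x y z (proj₁ (to T-∧ pq)) (proj₂ (to T-∧ pq))

Minimal : ∀ {n} → BRel n → Fin n → Set
Minimal R x = ∀ y → T (R y x) → y ≡ x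

T-isMinimalᵇ : ∀ {n} {R : BRel n} {x} → T (isMinimalᵇ R x) ⇔ Minimal R x
T-isMinimalᵇ {n} = mk⇔
  (λ h y y≤x → to T-==F (to T-not-∨ (to (T-allF n) h y) y≤x))
  (λ min → from (T-allF n) λ y → from T-not-∨ (from T-==F ∘ min y))

record IsExtension (m : ℕ) {k : ℕ} (Q : BRel k) (R : BRel (m + k)) : Set where
  field
    isPartialOrder : IsPartialOrder R
    induces        : ∀ i j → R (m ↑ʳ i) (m ↑ʳ j) ≡ Q i j
    minimal-M      : ∀ i → Minimal R (i ↑ˡ k)
    nonMinimal-L   : ∀ j → ¬ Minimal R (m ↑ʳ j)

T-isExtensionᵇ : ∀ m {k} {Q : BRel k} {R : BRel (m + k)} →
                 T (isExtensionᵇ m Q R) ⇔ IsExtension m Q R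
T-isExtensionᵇ m {k} {Q} {R} = mk⇔ decode encode
  where
  inducesᵇ minimal-Mᵇ : Bool
  inducesᵇ   = allF k λ i → allF k λ j → R (m ↑ʳ i) (m ↑ʳ j) ==B Q i j
  minimal-Mᵇ = allF m λ i → isMinimalᵇ R (i ↑ˡ k)

  decode : T (isExtensionᵇ m Q R) → IsExtension m Q R
  decode h with to (T-∧ {isPartialOrderᵇ R}) h
  ... | po , h′ with to (T-∧ {inducesᵇ}) h′
  ... | ind , h″ with to (T-∧ {minimal-Mᵇ}) h″
  ... | min , nonmin = record
    { isPartialOrder = to T-isPartialOrderᵇ po
    ; induces        = λ i j → to T-==B (to (T-allF k) (to (T-allF k) ind i) j)
    ; minimal-M      = λ i → to (T-isMinimalᵇ {R = R}) (to (T-allF m) min i)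
    ; nonMinimal-L   = λ j → to T-not (to (T-allF k) nonmin j) ∘ from (T-isMinimalᵇ {R = R})
    }

  encode : IsExtension m Q R → T (isExtensionᵇ m Q R)
  encode ext = from T-∧ (from T-isPartialOrderᵇ isPartialOrder , from T-∧
    ( from (T-allF k) (λ i → from (T-allF k) λ j → from T-==B (induces i j))
    , from T-∧ ( from (T-allF m) (λ i → from (T-isMinimalᵇ {R = R}) (minimal-M i))
               , from (T-allF k) (λ j → from T-not (nonMinimal-L j ∘ to (T-isMinimalᵇ {R = R}))))))
    where open IsExtension ext

module _ {n} {R : BRel n} (po : IsPartialOrder R) where
  open IsPartialOrder po

  T-isPartialOrder : Structures.IsPartialOrder _≡_ (λ x y → T (R x y))
  T-isPartialOrder = record
    { isPreorder = record
      { isEquivalence = ≡.isEquivalence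
      ; reflexive     = λ { refl → reflexive _ }
      ; trans         = transitive _ _ _
      }
    ; antisym = antisymmetric _ _
    }

  ≤⇒≡? : ∀ x y → Dec (T (R y x) → y ≡ x)
  ≤⇒≡? x y = T? (R y x) →-dec (y ≟ x)

  minimal? : ∀ x → Dec (Minimal R x)
  minimal? x = all? (≤⇒≡? x)

  nonMinimal⇒∃below : ∀ {x} → ¬ Minimal R x → ∃ λ y → T (R y x) × y ≢ x
  nonMinimal⇒∃below {x} ¬min with ¬∀⟶∃¬ n _ (≤⇒≡? x) ¬min
  ... | y , ¬[y≤x⇒y≡x] with T? (R y x)
  ...   | yes y≤x = y , y≤x , λ y≡x → ¬[y≤x⇒y≡x] λ _ → y≡x
  ...   | no  y≰x = contradiction (λ y≤x → contradiction y≤x y≰x) ¬[y≤x⇒y≡x]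

  minimal-below : ∀ x → ∃ λ z → Minimal R z × T (R z x)
  minimal-below x = go x (po-wellFounded T-isPartialOrder x)
    where
    go : ∀ x → Acc _ x → ∃ λ z → Minimal R z × T (R z x)
    go x (acc below) with minimal? x
    ... | yes min = x , min , reflexive x
    ... | no ¬min with nonMinimal⇒∃below ¬min
    ...   | y , y≤x , y≢x with go y (below (y≤x , y≢x))
    ...     | z , min-z , z≤y = z , min-z , transitive z y x z≤y y≤x

module _ {n} {R R′ : BRel n} (R≋R′ : ∀ x y → R x y ≡ R′ x y) where
  private
    ⇒ : ∀ {x y} → T (R x y) → T (R′ x y)
    ⇒ {x} {y} = subst T (R≋R′ x y)
    ⇐ : ∀ {x y} → T (R′ x y) → T (R x y)
    ⇐ {x} {y} = subst T (≡.sym (R≋R′ x y))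

  IsPartialOrder-resp : IsPartialOrder R → IsPartialOrder R′
  IsPartialOrder-resp po = record
    { reflexive     = ⇒ ∘ reflexive
    ; antisymmetric = λ x y p q → antisymmetric x y (⇐ p) (⇐ q)
    ; transitive    = λ x y z p q → ⇒ (transitive x y z (⇐ p) (⇐ q))
    }
    where open IsPartialOrder po

  Minimal-resp : ∀ {x} → Minimal R x → Minimal R′ x
  Minimal-resp min y = min y ∘ ⇐


IsExtension-resp : ∀ {m k} {Q : BRel k} {R R′ : BRel (m + k)} →
                   (∀ u v → R u v ≡ R′ u v) → IsExtension m Q R → IsExtension m Q R′
IsExtension-resp R≋R′ ext = record
  { isPartialOrder = IsPartialOrder-resp R≋R′ isPartialOrder
  ; induces        = λ i j → ≡.trans (≡.sym (R≋R′ _ _)) (induces i j)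
  ; minimal-M      = Minimal-resp R≋R′ ∘ minimal-M
  ; nonMinimal-L   = λ j → nonMinimal-L j ∘ Minimal-resp (λ u v → ≡.sym (R≋R′ u v))
  }
  where open IsExtension ext

data Split (m : ℕ) {k : ℕ} : Fin (m + k) → Set where
  left  : (i : Fin m) → Split m (i ↑ˡ k)
  right : (j : Fin k) → Split m (m ↑ʳ j)

split : ∀ m {k} (u : Fin (m + k)) → Split m u
split m u with splitAt m u in eq
... | inj₁ i = subst (Split m) (splitAt⁻¹-↑ˡ eq) (left i)
... | inj₂ j = subst (Split m) (splitAt⁻¹-↑ʳ eq) (right j)

↑ˡ≢↑ʳ : ∀ m {k} (i : Fin m) (j : Fin k) → i ↑ˡ k ≢ m ↑ʳ j
↑ˡ≢↑ʳ m {k} i j eq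
  with ≡.trans (≡.sym (splitAt-↑ˡ m i k)) (≡.trans (cong (splitAt m) eq) (splitAt-↑ʳ m k j))
... | ()

module _ {m k} {Q : BRel k} {R : BRel (m + k)} (ext : IsExtension m Q R) where
  open IsExtension ext

  L≰M : ∀ j i → ¬ T (R (m ↑ʳ j) (i ↑ˡ k))
  L≰M j i j≤i = ↑ˡ≢↑ʳ m i j (≡.sym (minimal-M i _ j≤i))

  M≰M : ∀ {i i′} → i ≢ i′ → ¬ T (R (i ↑ˡ k) (i′ ↑ˡ k))
  M≰M {i} {i′} i≢i′ i≤i′ = i≢i′ (↑ˡ-injective k i i′ (minimal-M i′ _ i≤i′))

  L-above-M : ∀ j → ∃ λ i → T (R (i ↑ˡ k) (m ↑ʳ j))
  L-above-M j with minimal-below isPartialOrder (m ↑ʳ j)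
  ... | z , min-z , z≤j with split m z
  ...   | left i   = i , z≤j
  ...   | right j′ = contradiction min-z (nonMinimal-L j′)

extension-determined-by-M×L : ∀ {m k} {Q : BRel k} {R₁ R₂ : BRel (m + k)} →
  IsExtension m Q R₁ → IsExtension m Q R₂ →
              (∀ i j → R₁ (i ↑ˡ k) (m ↑ʳ j) ≡ R₂ (i ↑ˡ k) (m ↑ʳ j)) → ∀ u v → R₁ u v ≡ R₂ u v
extension-determined-by-M×L {m} ext₁ ext₂ M×L u v with split m u | split m v
... | left i  | right j  = M×L i j
... | right j | right j′ = ≡.trans (IsExtension.induces ext₁ j j′) (≡.sym (IsExtension.induces ext₂ j j′))
... | right j | left i   = T-⇔→≡ (mk⇔ (⊥-elim ∘ (L≰M ext₁ j i)) (⊥-elim ∘ (L≰M ext₂ j i)))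
... | left i  | left i′ with i ≟ i′
...   | yes refl = T-⇔→≡ (mk⇔ (λ _ → IsPartialOrder.reflexive (IsExtension.isPartialOrder ext₂) _)
                             (λ _ → IsPartialOrder.reflexive (IsExtension.isPartialOrder ext₁) _))
...   | no i≢i′ = T-⇔→≡ (mk⇔ (⊥-elim ∘ (M≰M ext₁ i≢i′)) (⊥-elim ∘ (M≰M ext₂ i≢i′)))

module Gluing
  {n} (P : BRel n) (P-po : IsPartialOrder P) (D : Subset n) (D-down : IsDownset P D)
  {k} (f : Fin k → Fin n) (f-injective : ∀ i j → f i ≡ f j → i ≡ j)
  (f-onto-∁D : ∀ x → T (not (D x)) ⇔ ∃ λ j → f j ≡ x) (m : ℕ) where

  open IsPartialOrder P-po

  Q : BRel k
  Q = induce P f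

  f∉D : ∀ j → T (not (D (f j)))
  f∉D j = from (f-onto-∁D (f j)) (j , refl)

  DP∖D : Subset n
  DP∖D x = not (D x) ∧ anyF n (λ y → D y ∧ P y x)

  DP∖D-elements : List (Fin n)
  DP∖D-elements = filterᵇ DP∖D (allFin n)

  DP∖D-intro : ∀ {y z} → T (D y) → T (P y z) → T (not (D z)) → T (DP∖D z)
  DP∖D-intro {y} y∈D y≤z z∉D = from T-∧ (z∉D , from (T-anyF n) (y , from T-∧ (y∈D , y≤z)))

  DP∖D-mono : ∀ {y z} → T (DP∖D y) → T (P y z) → T (not (D z)) → T (DP∖D z)
  DP∖D-mono {y} {z} y∈DP∖D y≤z z∉D with to (T-anyF n) (proj₂ (to T-∧ y∈DP∖D))
  ... | d , d∈D,d≤y with to T-∧ d∈D,d≤y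
  ...   | d∈D , d≤y = DP∖D-intro d∈D (transitive d y z d≤y y≤z) z∉D

  lookup-DP∖D-elements : ∀ {y} → T (DP∖D y) → ∃ λ p → lookup DP∖D-elements p ≡ y
  lookup-DP∖D-elements y∈DP∖D =
    let y∈ = ∈-filter⁺ (T? ∘ DP∖D) (∈-allFin _) y∈DP∖D in index y∈ , ≡.sym (Any.lookup-index y∈)

  module _ (R′ : BRel (m + k)) where

    below : Fin m → Fin n → Bool
    below i y = anyF k λ j → (f j ==F y) ∧ R′ (i ↑ˡ k) (m ↑ʳ j)

    T-below : ∀ {i j} → T (below i (f j)) ⇔ T (R′ (i ↑ˡ k) (m ↑ʳ j))
    T-below {i} {j} = mk⇔
      (λ h → let j′ , fj′≡fj,i≤j′ = to (T-anyF k) h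
                 fj′≡fj , i≤j′ = to T-∧ fj′≡fj,i≤j′
             in subst (λ j → T (R′ (i ↑ˡ k) (m ↑ʳ j))) (f-injective j′ j (to T-==F fj′≡fj)) i≤j′)
      (λ i≤j → from (T-anyF k) (j , from T-∧ (from T-==F refl , i≤j)))

    module _ (ext : IsExtension m Q R′) where
      open IsExtension ext using (induces) renaming (isPartialOrder to R′-po)

      below-mono : ∀ {i y z} → T (below i y) → T (P y z) → T (not (D z)) → T (below i z)
      below-mono {i} {y} {z} i≤y y≤z z∉D
        with to (T-anyF k) i≤y | to (f-onto-∁D z) z∉D
      ... | j , fj≡y,i≤j | j′ , refl
        with to T-∧ fj≡y,i≤j
      ... | fj≡y , i≤j with to (T-==F {x = f j} {y}) fj≡y
      ... | refl = from T-below
              (IsPartialOrder.transitive R′-po _ _ _ i≤j (subst T (≡.sym (induces j j′)) y≤z))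

    module _ (a : Fin m) where

      _≤ᵍ_ : Fin m ⊎ Fin n → Fin m ⊎ Fin n → Bool
      inj₁ i ≤ᵍ inj₁ i′ = i ==F i′
      inj₁ i ≤ᵍ inj₂ y  = if D y then i ==F a else below i y ∨ ((i ==F a) ∧ DP∖D y)
      inj₂ _ ≤ᵍ inj₁ _  = false
      inj₂ x ≤ᵍ inj₂ y  = P x y

      glue : BRel (m + n)
      glue u v = splitAt m u ≤ᵍ splitAt m v

      code : Fin (upDiffSize P D) → Bool
      code p = below a (lookup DP∖D-elements p)

      glue-join : ∀ x y → glue (join m n x) (join m n y) ≡ x ≤ᵍ y
      glue-join x y rewrite splitAt-join m n x | splitAt-join m n y = refl

      T-≤ᵍ-D : ∀ {i y} → T (D y) → T (inj₁ i ≤ᵍ inj₂ y) ⇔ i ≡ a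
      T-≤ᵍ-D y∈D rewrite to T-≡ y∈D = T-==F

      T-≤ᵍ-∁D : ∀ {i y} → T (not (D y)) →
                T (inj₁ i ≤ᵍ inj₂ y) ⇔ (T (below i y) ⊎ (i ≡ a × T (DP∖D y)))
      T-≤ᵍ-∁D y∉D rewrite to T-not-≡ y∉D = mk⇔
        (Sum.map₂ (Product.map₁ (to T-==F) ∘ to T-∧) ∘ to T-∨)
        (from T-∨ ∘ Sum.map₂ (from T-∧ ∘ Product.map₁ (from T-==F)))

      ≤ᵍ-refl : ∀ u → T (u ≤ᵍ u)
      ≤ᵍ-refl (inj₁ i) = from T-==F refl
      ≤ᵍ-refl (inj₂ x) = reflexive x

      ≤ᵍ-antisym : ∀ u v → T (u ≤ᵍ v) → T (v ≤ᵍ u) → u ≡ v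
      ≤ᵍ-antisym (inj₁ i) (inj₁ i′) i≤i′ _ = cong inj₁ (to T-==F i≤i′)
      ≤ᵍ-antisym (inj₂ x) (inj₂ y)  x≤y y≤x = cong inj₂ (antisymmetric x y x≤y y≤x)

      module _ (ext : IsExtension m Q R′) where

        M≤K-mono : ∀ {i y z} → T (inj₁ i ≤ᵍ inj₂ y) → T (P y z) → T (inj₁ i ≤ᵍ inj₂ z)
        M≤K-mono {i} {y} {z} i≤y y≤z with T-dichotomy (D z) | T-dichotomy (D y)
        ... | inj₁ z∈D | _ = from (T-≤ᵍ-D z∈D) (to (T-≤ᵍ-D (D-down y z z∈D y≤z)) i≤y)
        ... | inj₂ z∉D | inj₁ y∈D =
          from (T-≤ᵍ-∁D z∉D) (inj₂ (to (T-≤ᵍ-D y∈D) i≤y , DP∖D-intro y∈D y≤z z∉D))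
        ... | inj₂ z∉D | inj₂ y∉D =
          from (T-≤ᵍ-∁D z∉D) (Sum.map (λ i≤y → below-mono ext i≤y y≤z z∉D)
                                      (Product.map₂ (λ y∈ → DP∖D-mono y∈ y≤z z∉D))
                                      (to (T-≤ᵍ-∁D y∉D) i≤y))

        ≤ᵍ-trans : ∀ u v w → T (u ≤ᵍ v) → T (v ≤ᵍ w) → T (u ≤ᵍ w)
        ≤ᵍ-trans (inj₁ i) (inj₁ i′) w        i≤i′ i′≤w with to T-==F i≤i′
        ... | refl = i′≤w
        ≤ᵍ-trans (inj₁ i) (inj₂ y)  (inj₂ z) i≤y  y≤z = M≤K-mono i≤y y≤z
        ≤ᵍ-trans (inj₂ x) (inj₂ y)  (inj₂ z) x≤y  y≤z = transitive x y z x≤y y≤z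

        glue-isPartialOrder : IsPartialOrder glue
        glue-isPartialOrder = record
          { reflexive     = ≤ᵍ-refl ∘ splitAt m
          ; antisymmetric = λ u v u≤v v≤u → begin
              u                      ≡⟨ join-splitAt m n u ⟨
              join m n (splitAt m u) ≡⟨ cong (join m n) (≤ᵍ-antisym (splitAt m u) _ u≤v v≤u) ⟩
              join m n (splitAt m v) ≡⟨ join-splitAt m n v ⟩
              v                      ∎
          ; transitive    = λ u v w → ≤ᵍ-trans (splitAt m u) (splitAt m v) (splitAt m w)
          }
          where open ≡.≡-Reasoning

        M≤K⇒nonMinimal : ∀ {i x} → T (inj₁ i ≤ᵍ inj₂ x) → ¬ Minimal glue (m ↑ʳ x)
        M≤K⇒nonMinimal {i} {x} i≤x min =
          ↑ˡ≢↑ʳ m i x (min (i ↑ˡ n) (subst T (≡.sym (glue-join (inj₁ i) (inj₂ x))) i≤x))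

        glue-isExtension : IsExtension m P glue
        glue-isExtension = record
          { isPartialOrder = glue-isPartialOrder
          ; induces        = λ x y → glue-join (inj₂ x) (inj₂ y)
          ; minimal-M      = minimal-M
          ; nonMinimal-L   = nonMinimal-L
          }
          where
          minimal-M : ∀ i → Minimal glue (i ↑ˡ n)
          minimal-M i u u≤i with split m u
          ... | left i′ = cong (_↑ˡ n) (to T-==F (subst T (glue-join (inj₁ i′) (inj₁ i)) u≤i))
          ... | right x = ⊥-elim (subst T (glue-join (inj₂ x) (inj₁ i)) u≤i)
          nonMinimal-L : ∀ x → ¬ Minimal glue (m ↑ʳ x)
          nonMinimal-L x with T-dichotomy (D x)
          ... | inj₁ x∈D = M≤K⇒nonMinimal (from (T-≤ᵍ-D x∈D) refl)
          ... | inj₂ x∉D with to (f-onto-∁D x) x∉D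
          ...   | j , refl with L-above-M ext j
          ...     | i , i≤j = M≤K⇒nonMinimal (from (T-≤ᵍ-∁D x∉D) (inj₁ (from T-below i≤j)))

  ≤ᵍ-transfer : ∀ {R₁ a₁ R₂ a₂} → (∀ u v → glue R₁ a₁ u v ≡ glue R₂ a₂ u v) →
                ∀ x y → T (_≤ᵍ_ R₁ a₁ x y) → T (_≤ᵍ_ R₂ a₂ x y)
  ≤ᵍ-transfer {R₁} {a₁} {R₂} {a₂} glues x y =
    subst T (≡.trans (≡.sym (glue-join R₁ a₁ x y)) (≡.trans (glues _ _) (glue-join R₂ a₂ x y)))

  glue-determines-a : ∀ {d₀} → T (D d₀) → ∀ {R₁ a₁ R₂ a₂} →
                      (∀ u v → glue R₁ a₁ u v ≡ glue R₂ a₂ u v) → a₁ ≡ a₂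
  glue-determines-a d₀∈D {R₁} {a₁} {R₂} {a₂} glues =
    to (T-≤ᵍ-D R₂ a₂ d₀∈D) (≤ᵍ-transfer glues (inj₁ a₁) (inj₂ _) (from (T-≤ᵍ-D R₁ a₁ d₀∈D) refl))

  recover-M×L : ∀ {a R₁ R₂} →
                (∀ p → code R₁ a p ≡ code R₂ a p) → (∀ u v → glue R₁ a u v ≡ glue R₂ a u v) →
                ∀ {i j} → T (R₁ (i ↑ˡ k) (m ↑ʳ j)) → T (R₂ (i ↑ˡ k) (m ↑ʳ j))
  recover-M×L {a} {R₁} {R₂} codes glues {i} {j} i≤₁j
    with from (T-below R₁) i≤₁j
  ... | i≤₁fj
    with to (T-≤ᵍ-∁D R₂ a (f∉D j))
            (≤ᵍ-transfer glues (inj₁ i) (inj₂ (f j)) (from (T-≤ᵍ-∁D R₁ a (f∉D j)) (inj₁ i≤₁fj)))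
  ... | inj₁ i≤₂fj = to (T-below R₂) i≤₂fj
  ... | inj₂ (refl , fj∈DP∖D) with lookup-DP∖D-elements fj∈DP∖D
  ...   | p , p↦fj = to (T-below R₂) (subst (T ∘ below R₂ a) p↦fj
                      (subst T (codes p) (subst (T ∘ below R₁ a) (≡.sym p↦fj) i≤₁fj)))

  gluing : Fin m × BRel (m + k) → (Fin (upDiffSize P D) → Bool) × BRel (m + n)
  gluing (a , R′) = code R′ a , glue R′ a

  Domain Codomain : Setoid 0ℓ 0ℓ
  Domain   = ≡.setoid (Fin m) ×ₛ Relations (m + k)
  Codomain = Subsets (upDiffSize P D) ×ₛ Relations (m + n)

  open SetoidMembership Codomain using (_∈_)

  gluing-injective : ∀ {d₀} → T (D d₀) →
                     ∀ {x y} → IsExtension m Q (proj₂ x) → IsExtension m Q (proj₂ y) →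
                     Setoid._≈_ Codomain (gluing x) (gluing y) → Setoid._≈_ Domain x y
  gluing-injective d₀∈D {a₁ , R₁} {a₂ , R₂} ext₁ ext₂ (codes , glues)
    with glue-determines-a d₀∈D glues
  ... | refl = refl , extension-determined-by-M×L ext₁ ext₂ λ i j → T-⇔→≡ (mk⇔
                 (recover-M×L codes glues)
                 (recover-M×L (≡.sym ∘ codes) (λ u v → ≡.sym (glues u v))))

  domain : List (Fin m × BRel (m + k))
  domain = cartesianProduct (allFin m) (filterᵇ (isExtensionᵇ m Q) (allBRel (m + k)))

  codomain : List ((Fin (upDiffSize P D) → Bool) × BRel (m + n))
  codomain = cartesianProduct (funs (upDiffSize P D) bools)
                              (filterᵇ (isExtensionᵇ m P) (allBRel (m + n)))

  length-domain : length domain ≡ m * e m Q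
  length-domain = ≡.trans (length-cartesianProductWith _,_ (allFin m) _)
                          (cong (_* e m Q) (length-tabulate {n = m} (λ i → i)))

  length-codomain : length codomain ≡ 2 ^ upDiffSize P D * e m P
  length-codomain = ≡.trans (length-cartesianProductWith _,_ (funs (upDiffSize P D) bools) _)
                    (cong (_* e m P) (length-funs (upDiffSize P D) bools))

  domain-unique : Unique Domain domain
  domain-unique = Unique.cartesianProduct⁺ (≡.setoid (Fin m)) (Relations (m + k))
                    (allFin⁺ m) (Unique.filter⁺ (Relations (m + k)) _ (allBRel-unique (m + k)))

  domain-extensions : All (IsExtension m Q ∘ proj₂) domain
  domain-extensions = All.cartesianProduct⁺ (≡.setoid (Fin m)) (≡.setoid (BRel (m + k)))
                        (allFin m) (filterᵇ (isExtensionᵇ m Q) (allBRel (m + k)))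
    λ _ R′∈ → to (T-isExtensionᵇ m) (proj₂ (∈-filter⁻ _ {xs = allBRel (m + k)} R′∈))

  gluing-∈ : ∀ {x} → IsExtension m Q (proj₂ x) → gluing x ∈ codomain
  gluing-∈ {a , R′} ext =
    Membershipₚ.∈-cartesianProduct⁺ (Subsets (upDiffSize P D)) (Relations (m + n))
    (funs-enumerates (≡.setoid Bool) _ bools-enumerates (code R′ a))
    (Membershipₚ.∈-filter⁺ (Relations (m + n)) (T? ∘ isExtensionᵇ m P)
      (λ R≋R″ → from (T-isExtensionᵇ m) ∘ IsExtension-resp R≋R″ ∘ to (T-isExtensionᵇ m))
      (allBRel-enumerates (m + n) (glue R′ a))
      (from (T-isExtensionᵇ m) (glue-isExtension R′ a ext)))

lemma6p1 : (n : ℕ) (P : BRel n) → IsPartialOrder P →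
           (D : Subset n) → IsDownset P D → (∃ λ x → T (D x)) →
           (m : ℕ) → 1 ≤ m →
           (k : ℕ) (f : Fin k → Fin n) →
           (∀ i j → f i ≡ f j → i ≡ j) →
           (∀ x → T (not (D x)) ⇔ (∃ λ i → f i ≡ x)) →
           m * e m (induce P f) ≤ 2 ^ upDiffSize P D * e m P
-- The bound is trivial for m = 0.
lemma6p1 n P P-po D D-down (d₀ , d₀∈D) m _ k f f-injective f-onto-∁D = begin
  m * e m Q                   ≡⟨ length-domain ⟨
  length domain               ≡⟨ length-map gluing domain ⟨
  length (map gluing domain)  ≤⟨ Unique-⊆⇒length≤ Codomain
                                   (map⁺-injectiveOn Domain Codomain (gluing-injective d₀∈D)
                                                     domain-extensions domain-unique)
                                   (All.map⁺ (All.map gluing-∈ domain-extensions)) ⟩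
  length codomain             ≡⟨ length-codomain ⟩
  2 ^ upDiffSize P D * e m P  ∎
  where
  open ≤-Reasoning
  open Gluing P P-po D D-down f f-injective f-onto-∁D m
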